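{- $\mathbf{Six}$ is not functionally complete: there is a function on $\mathbb{S}_6$ (for instance the unary constant function with value $N$) that is not expressible by any formula, i.e. there is no formula $\alpha$ with $Var(\alpha)\subseteq\{p\}$ such that $h(\alpha)=N$ for every homomorphism $h:\mathfrak{Fm}\to\mathbb{S}_6$.
   Context: $\mathbb{S}_6$ is the algebra with universe $\{0,\tfrac13,N,B,\tfrac23,1\}$, lattice order $0<\tfrac13<N<\tfrac23<1$, $\tfrac13<B<\tfrac23$, $N,B$ incomparable; $\neg$ swaps $0\leftrightarrow1$, $\tfrac13\leftrightarrow\tfrac23$ and fixes $N,B$; $\nabla0=0$, $\nabla x=1$ for $x\ne0$; it is the algebra of the matrices characterizing $\mathbf{Six}$. Formulas are built from a denumerable set of propositional variables with binary $\wedge,\vee$, unary $\neg,\nabla$ and constants $\bot,\top$; homomorphisms send $\bot\mapsto0,\top\mapsto1$. A logic (with this matrix semantics on $\mathbb{S}_6$) is functionally complete if every function $f:\mathbb{S}_6^n\to\mathbb{S}_6$ is expressed by some formula $\alpha(p_1,\dots,p_n)$, i.e. $h(\alpha)=f(h(p_1),\dots,h(p_n))$ for all homomorphisms $h$. -}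

module Defs where

open import Data.Nat using (ℕ; _<_)
open import Data.Fin using (Fin; toℕ)
open import Data.Product using (Σ; _×_)
open import Relation.Binary.PropositionalEquality using (_≡_)

data S6 : Set where
  s0 s⅓ sN sB s⅔ s1 : S6

-- lattice meet for 0 < 1/3 < N,B < 2/3 < 1 (N, B incomparable)
_∧₆_ : S6 → S6 → S6
s0 ∧₆ y = s0
s1 ∧₆ y = y
s⅓ ∧₆ s0 = s0
s⅓ ∧₆ y = s⅓
sN ∧₆ s0 = s0
sN ∧₆ s⅓ = s⅓
sN ∧₆ sN = sN
sN ∧₆ sB = s⅓
sN ∧₆ s⅔ = sN
sN ∧₆ s1 = sN
sB ∧₆ s0 = s0
sB ∧₆ s⅓ = s⅓
sB ∧₆ sN = s⅓
sB ∧₆ sB = sB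
sB ∧₆ s⅔ = sB
sB ∧₆ s1 = sB
s⅔ ∧₆ s1 = s⅔
s⅔ ∧₆ y = y

_∨₆_ : S6 → S6 → S6
s1 ∨₆ y = s1
s0 ∨₆ y = y
s⅔ ∨₆ s1 = s1
s⅔ ∨₆ y = s⅔
sN ∨₆ s0 = sN
sN ∨₆ s⅓ = sN
sN ∨₆ sN = sN
sN ∨₆ sB = s⅔
sN ∨₆ s⅔ = s⅔
sN ∨₆ s1 = s1
sB ∨₆ s0 = sB
sB ∨₆ s⅓ = sB
sB ∨₆ sN = s⅔
sB ∨₆ sB = sB
sB ∨₆ s⅔ = s⅔
sB ∨₆ s1 = s1
s⅓ ∨₆ s0 = s⅓
s⅓ ∨₆ y = y

¬₆_ : S6 → S6
¬₆ s0 = s1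
¬₆ s⅓ = s⅔
¬₆ sN = sN
¬₆ sB = sB
¬₆ s⅔ = s⅓
¬₆ s1 = s0

∇₆_ : S6 → S6
∇₆ s0 = s0
∇₆ _  = s1

data Fm : Set where
  var  : ℕ → Fm
  _∧ᶠ_  : Fm → Fm → Fm
  _∨ᶠ_  : Fm → Fm → Fm
  ¬ᶠ_  : Fm → Fm
  ∇ᶠ_  : Fm → Fm
  ⊥ᶠ   : Fm
  ⊤ᶠ   : Fm

-- Homomorphisms Fm → S6 are determined by (and identified with) valuations
-- of the variables; ⟦ α ⟧ h is the image of α under that homomorphism.
Hom : Set
Hom = ℕ → S6

⟦_⟧ : Fm → Hom → S6
⟦ var i ⟧ h = h i
⟦ α ∧ᶠ β ⟧ h = ⟦ α ⟧ h ∧₆ ⟦ β ⟧ h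
⟦ α ∨ᶠ β ⟧ h = ⟦ α ⟧ h ∨₆ ⟦ β ⟧ h
⟦ ¬ᶠ α ⟧ h = ¬₆ ⟦ α ⟧ h
⟦ ∇ᶠ α ⟧ h = ∇₆ ⟦ α ⟧ h
⟦ ⊥ᶠ ⟧ h = s0
⟦ ⊤ᶠ ⟧ h = s1

data VarsIn (S : ℕ → Set) : Fm → Set where
  vvar : ∀ {i} → S i → VarsIn S (var i)
  v∧   : ∀ {α β} → VarsIn S α → VarsIn S β → VarsIn S (α ∧ᶠ β)
  v∨   : ∀ {α β} → VarsIn S α → VarsIn S β → VarsIn S (α ∨ᶠ β)
  v¬   : ∀ {α} → VarsIn S α → VarsIn S (¬ᶠ α)
  v∇   : ∀ {α} → VarsIn S α → VarsIn S (∇ᶠ α)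
  v⊥   : VarsIn S ⊥ᶠ
  v⊤   : VarsIn S ⊤ᶠ

Expresses : (n : ℕ) → ((Fin n → S6) → S6) → Fm → Set
Expresses n f α =
  VarsIn (λ i → i < n) α × ((h : Hom) → ⟦ α ⟧ h ≡ f (λ k → h (toℕ k)))

FunctionallyComplete : Set
FunctionallyComplete =
  (n : ℕ) → (f : (Fin n → S6) → S6) → Σ Fm (Expresses n f)

-- The two-element set {0, 1} is closed under all operations of S6 and contains
-- the interpretations of ⊥ and ⊤, so a homomorphism sending every variable into
-- {0, 1} sends every formula into {0, 1}. In particular no formula takes the
-- value N under all homomorphisms, so the constant function N is not expressible.
{-# OPTIONS --safe #-}
module Submission where

open import Defs
open import Data.Product using (Σ; _×_; _,_)
open import Relation.Nullary using (¬_)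
open import Relation.Binary.PropositionalEquality using (_≡_; subst)

data Classical : S6 → Set where
  c0 : Classical s0
  c1 : Classical s1

sN-nonClassical : ¬ Classical sN
sN-nonClassical ()

∧₆-classical : ∀ {x y} → Classical x → Classical y → Classical (x ∧₆ y)
∧₆-classical c0 _ = c0
∧₆-classical c1 y = y

∨₆-classical : ∀ {x y} → Classical x → Classical y → Classical (x ∨₆ y)
∨₆-classical c0 y = y
∨₆-classical c1 _ = c1

¬₆-classical : ∀ {x} → Classical x → Classical (¬₆ x)
¬₆-classical c0 = c1
¬₆-classical c1 = c0

∇₆-classical : ∀ x → Classical (∇₆ x)
∇₆-classical s0 = c0
∇₆-classical s⅓ = c1
∇₆-classical sN = c1
∇₆-classical sB = c1
∇₆-classical s⅔ = c1
∇₆-classical s1 = c1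

⟦⟧-classical : ∀ {h : Hom} → (∀ i → Classical (h i)) → ∀ α → Classical (⟦ α ⟧ h)
⟦⟧-classical hc (var i) = hc i
⟦⟧-classical hc (α ∧ᶠ β) = ∧₆-classical (⟦⟧-classical hc α) (⟦⟧-classical hc β)
⟦⟧-classical hc (α ∨ᶠ β) = ∨₆-classical (⟦⟧-classical hc α) (⟦⟧-classical hc β)
⟦⟧-classical hc (¬ᶠ α) = ¬₆-classical (⟦⟧-classical hc α)
⟦⟧-classical {h} hc (∇ᶠ α) = ∇₆-classical (⟦ α ⟧ h)
⟦⟧-classical hc ⊥ᶠ = c0
⟦⟧-classical hc ⊤ᶠ = c1

no-formula-constantly-sN : ¬ Σ Fm (λ α → (h : Hom) → ⟦ α ⟧ h ≡ sN)
no-formula-constantly-sN (α , ≡sN) =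
  sN-nonClassical (subst Classical (≡sN allZero) (⟦⟧-classical (λ _ → c0) α))
  where
  allZero : Hom
  allZero _ = s0

mainTheorem12 : (¬ FunctionallyComplete)
    × (¬ Σ Fm (λ α → VarsIn (λ i → i ≡ 0) α × ((h : Hom) → ⟦ α ⟧ h ≡ sN)))
mainTheorem12 = constant-sN-inexpressible , unary-constant-sN-inexpressible
  where
  constant-sN-inexpressible : ¬ FunctionallyComplete
  constant-sN-inexpressible complete with complete 1 (λ _ → sN)
  ... | α , _ , expresses = no-formula-constantly-sN (α , expresses)

  unary-constant-sN-inexpressible :
    ¬ Σ Fm (λ α → VarsIn (λ i → i ≡ 0) α × ((h : Hom) → ⟦ α ⟧ h ≡ sN))
  unary-constant-sN-inexpressible (α , _ , expresses) =
    no-formula-constantly-sN (α , expresses)
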